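{- Let $p$ be an odd prime and $a,b,k\in\mathbb{Z}$ with $k\ge1$ and $(b,p)=1$. Let $\zeta$ be a primitive $p^k$-th root of unity, let $f\in(\mathbb{Z}/p^k\mathbb{Z})[t]$, and define $g:\mathbb{Z}/p^k\mathbb{Z}\to\mathbb{Z}/p^k\mathbb{Z}$ by $g(t)=a+bt+pf(t)$. Then $$\sum_{t=0}^{p^k-1}\zeta^{g(t)}=\sum_{t=0}^{p^k-1}\zeta^{a+bt}=0.$$ -}

module Defs where

open import Level using (_⊔_)
open import Algebra.Bundles using (CommutativeRing)
import Algebra.Bundles
open import Data.Nat as ℕ using (ℕ; zero; suc; _<_)
open import Data.Nat.Properties using (m^n≢0)
open import Data.Nat.Primality using (Prime; prime⇒nonZero)
open import Data.Integer as ℤ using (ℤ; _%ℕ_)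
open import Data.List using (List; []; _∷_)
open import Data.Product using (_×_)
open import Data.Sum using (_⊎_)
open import Relation.Nullary using (¬_)

-- Evaluation of a polynomial given by its coefficient list [c₀, c₁, …] (Horner).
-- A polynomial over ℤ/p^kℤ is represented by integer lifts of its coefficients.
evalPoly : List ℤ → ℤ → ℤ
evalPoly []       x = ℤ.0ℤ
evalPoly (c ∷ cs) x = c ℤ.+ x ℤ.* evalPoly cs x

residue : (p k : ℕ) → Prime p → ℤ → ℕ
residue p k pp x =
  let instance _ = prime⇒nonZero pp
               _ = m^n≢0 p k
  in x %ℕ (p ℕ.^ k)

module _ {c ℓ} (R : CommutativeRing c ℓ) where
  open CommutativeRing R
  open import Algebra.Definitions.RawSemiring (Algebra.Bundles.Semiring.rawSemiring semiring) using (_^_)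

  IsPrimitiveRoot : Carrier → ℕ → Set ℓ
  IsPrimitiveRoot ζ n = (ζ ^ n ≈ 1#) × (∀ m → 0 < m → m < n → ¬ (ζ ^ m ≈ 1#))

  -- No zero divisors (the ring behaves like ℂ in this respect).
  NoZeroDivisors : Set (c ⊔ ℓ)
  NoZeroDivisors = ∀ x y → x * y ≈ 0# → (x ≈ 0#) ⊎ (y ≈ 0#)

  sumBelow : ℕ → (ℕ → Carrier) → Carrier
  sumBelow zero    F = 0#
  sumBelow (suc n) F = sumBelow n F + F n

  -- ζ raised to an exponent in ℤ/p^kℤ (well defined as ζ^(p^k) = 1).
  powMod : (p k : ℕ) → Prime p → Carrier → ℤ → Carrier
  powMod p k pp ζ e = ζ ^ residue p k pp e

RingEq : ∀ {c ℓ} (R : CommutativeRing c ℓ) →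
  CommutativeRing.Carrier R → CommutativeRing.Carrier R → Set ℓ
RingEq R = CommutativeRing._≈_ R

{-# OPTIONS --safe #-}
-- Write N = p ^ k and g t = a + b t + p f(t).  Since s − t divides f(s) − f(t), we have
-- g s − g t = (s − t)(b + p q) for some integer q, and b + p q is prime to p, hence to N.
-- So t ↦ g t mod N is injective on [0, N), i.e. a permutation of it, and both sums equal
-- ∑_{r<N} ζ^r.  That sum S vanishes: ζ S = S because ζ^N = 1, so (ζ − 1) S = 0 with ζ ≠ 1.
-- The argument works for p = 2 as well.
module Submission where

open import Defs
open import Algebra.Bundles using (CommutativeRing)
open import Data.Nat as ℕ using (ℕ; zero; suc; _≤_; _<_; _^_; NonZero)
import Data.Nat.Properties as ℕ
import Data.Nat.Divisibility as ℕ
open import Data.Nat.Primality using (Prime; prime⇒nonZero; prime⇒nonTrivial)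
open import Data.Nat.Coprimality using (Coprime)
import Data.Nat.Coprimality as ℕCoprime
open import Data.Fin as Fin using (Fin; toℕ; fromℕ<; punchOut)
import Data.Fin.Properties as Fin
open import Data.Fin.Permutation using (Permutation′; permutation)
open import Data.List using (List; []; _∷_)
open import Data.Product using (_×_; _,_; ∃; proj₁; proj₂)
open import Data.Sum using (inj₁; inj₂)
open import Function using (_∘_; Injective)
open import Relation.Nullary using (¬_; yes; no; contradiction)
open import Relation.Binary.PropositionalEquality as ≡ using (_≡_; _≢_)

injective⇒surjective : ∀ {n} {f : Fin n → Fin n} → Injective _≡_ _≡_ f → ∀ i → ∃ λ j → f j ≡ i
injective⇒surjective {suc n} {f} f-inj i with Fin.any? (λ j → f j Fin.≟ i)
... | yes hit = hit
... | no  miss = contradiction (Fin.injective⇒≤ punchOut∘f-injective) ℕ.1+n≰n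
  where
  f≢i : ∀ j → i ≢ f j
  f≢i j i≡fj = miss (j , ≡.sym i≡fj)
  punchOut∘f-injective : Injective _≡_ _≡_ (λ j → punchOut (f≢i j))
  punchOut∘f-injective = f-inj ∘ Fin.punchOut-injective (f≢i _) (f≢i _)

injective⇒permutation : ∀ {n} (f : Fin n → Fin n) → Injective _≡_ _≡_ f → Permutation′ n
injective⇒permutation f f-inj =
  permutation f (proj₁ ∘ surj) (proj₂ ∘ surj) (λ j → f-inj (proj₂ (surj (f j))))
  where surj = injective⇒surjective f-inj

module _ {c ℓ} (R : CommutativeRing c ℓ) where
  open CommutativeRing R
  open import Algebra.Definitions.RawSemiring (Algebra.Bundles.Semiring.rawSemiring semiring)
    using () renaming (_^_ to _^ᴿ_)
  open import Algebra.Properties.CommutativeMonoid.Sum +-commutativeMonoid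
    using (sum; sum-init-last; sum-cong-≗; sum-permute)
  open import Algebra.Properties.Group +-group using (∙-cancelʳ; x≈y⇒x∙y⁻¹≈ε; x∙y⁻¹≈ε⇒x≈y)
  open import Algebra.Properties.Ring ring using ([y-z]x≈yx-zx)
  open import Relation.Binary.Reasoning.Setoid setoid

  sumBelow≈sum : ∀ n (F : ℕ → Carrier) → sumBelow R n F ≈ sum (F ∘ toℕ {n})
  sumBelow≈sum zero    F = refl
  sumBelow≈sum (suc n) F = begin
    sumBelow R n F + F n                                    ≈⟨ +-congʳ (sumBelow≈sum n F) ⟩
    sum (F ∘ toℕ {n}) + F n                                 ≡⟨ ≡.cong₂ _+_ init≡ last≡ ⟩
    sum (F ∘ toℕ ∘ Fin.inject₁ {n}) + F (toℕ (Fin.fromℕ n)) ≈⟨ sym (sum-init-last {n} (F ∘ toℕ)) ⟩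
    sum (F ∘ toℕ {suc n})                                   ∎
    where
    init≡ : sum (F ∘ toℕ {n}) ≡ sum (F ∘ toℕ ∘ Fin.inject₁ {n})
    init≡ = sum-cong-≗ {n} (≡.cong F ∘ ≡.sym ∘ Fin.toℕ-inject₁)
    last≡ : F n ≡ F (toℕ (Fin.fromℕ n))
    last≡ = ≡.cong F (≡.sym (Fin.toℕ-fromℕ n))

  sumBelow-reindex : ∀ n (F : ℕ → Carrier) (σ : ℕ → ℕ) → (∀ t → t < n → σ t < n) →
                     (∀ s t → s < n → t < n → σ s ≡ σ t → s ≡ t) →
                     sumBelow R n (F ∘ σ) ≈ sumBelow R n F
  sumBelow-reindex n F σ σ-bounded σ-injective = begin
    sumBelow R n (F ∘ σ)      ≈⟨ sumBelow≈sum n (F ∘ σ) ⟩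
    sum (F ∘ σ ∘ toℕ {n})     ≡⟨ sum-cong-≗ (≡.cong F ∘ ≡.sym ∘ toℕ-σ̂) ⟩
    sum (F ∘ toℕ ∘ σ̂)         ≈⟨ sym (sum-permute (F ∘ toℕ) σ̂-permutation) ⟩
    sum (F ∘ toℕ {n})         ≈⟨ sym (sumBelow≈sum n F) ⟩
    sumBelow R n F            ∎
    where
    σ̂ : Fin n → Fin n
    σ̂ i = fromℕ< (σ-bounded (toℕ i) (Fin.toℕ<n i))
    toℕ-σ̂ : ∀ i → toℕ (σ̂ i) ≡ σ (toℕ i)
    toℕ-σ̂ i = Fin.toℕ-fromℕ< _
    σ̂-injective : Injective _≡_ _≡_ σ̂
    σ̂-injective {i} {j} σ̂i≡σ̂j = Fin.toℕ-injective (σ-injective _ _ (Fin.toℕ<n i) (Fin.toℕ<n j)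
      (≡.trans (≡.sym (toℕ-σ̂ i)) (≡.trans (≡.cong toℕ σ̂i≡σ̂j) (toℕ-σ̂ j))))
    σ̂-permutation : Permutation′ n
    σ̂-permutation = injective⇒permutation σ̂ σ̂-injective

  powers-telescope : ∀ ζ n → ζ * sumBelow R n (ζ ^ᴿ_) + 1# ≈ sumBelow R n (ζ ^ᴿ_) + ζ ^ᴿ n
  powers-telescope ζ zero    = +-congʳ (zeroʳ ζ)
  powers-telescope ζ (suc n) = begin
    ζ * (S + ζ ^ᴿ n) + 1#     ≈⟨ +-congʳ (distribˡ ζ S (ζ ^ᴿ n)) ⟩
    ζ * S + ζ ^ᴿ suc n + 1#   ≈⟨ +-assoc _ _ _ ⟩
    ζ * S + (ζ ^ᴿ suc n + 1#) ≈⟨ +-congˡ (+-comm _ _) ⟩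
    ζ * S + (1# + ζ ^ᴿ suc n) ≈⟨ sym (+-assoc _ _ _) ⟩
    ζ * S + 1# + ζ ^ᴿ suc n   ≈⟨ +-congʳ (powers-telescope ζ n) ⟩
    S + ζ ^ᴿ n + ζ ^ᴿ suc n   ∎
    where S = sumBelow R n (ζ ^ᴿ_)

  sumBelow-rootOfUnity≈0 : NoZeroDivisors R → ∀ {ζ} n → ζ ^ᴿ n ≈ 1# → ¬ ζ ≈ 1# →
                           sumBelow R n (ζ ^ᴿ_) ≈ 0#
  sumBelow-rootOfUnity≈0 noZeroDivisors {ζ} n ζⁿ≈1 ζ≉1
    with noZeroDivisors (ζ - 1#) S [ζ-1]S≈0
    where
    S = sumBelow R n (ζ ^ᴿ_)
    ζS≈S : ζ * S ≈ S
    ζS≈S = ∙-cancelʳ 1# (ζ * S) S (trans (powers-telescope ζ n) (+-congˡ ζⁿ≈1))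
    [ζ-1]S≈0 : (ζ - 1#) * S ≈ 0#
    [ζ-1]S≈0 = begin
      (ζ - 1#) * S     ≈⟨ [y-z]x≈yx-zx S ζ 1# ⟩
      ζ * S - 1# * S   ≈⟨ +-congˡ (-‿cong (*-identityˡ S)) ⟩
      ζ * S - S        ≈⟨ x≈y⇒x∙y⁻¹≈ε ζS≈S ⟩
      0#               ∎
  ... | inj₁ ζ-1≈0 = contradiction (x∙y⁻¹≈ε⇒x≈y ζ 1# ζ-1≈0) ζ≉1
  ... | inj₂ S≈0   = S≈0

  primitiveRoot⇒≉1 : ∀ {ζ n} → IsPrimitiveRoot R ζ n → 1 < n → ¬ ζ ≈ 1#
  primitiveRoot⇒≉1 {ζ} (_ , no-smaller-order) 1<n ζ≈1 =
    no-smaller-order 1 (ℕ.s≤s ℕ.z≤n) 1<n (trans (*-identityʳ ζ) ζ≈1)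

open import Data.Integer as ℤ using (ℤ; _+_; _*_; _-_; +_; ∣_∣; _%ℕ_; _/ℕ_)
import Data.Integer.Properties as ℤ
open import Data.Integer.DivMod using (a≡a%ℕn+[a/ℕn]*n; n%ℕd<d)
open import Data.Integer.Divisibility using () renaming (_∣_ to _∣ᵤ_)
open import Data.Integer.Divisibility.Signed as ℤ∣ₛ using (_∣_; divides)
import Data.Integer.Coprimality as ℤCoprime
open import Data.Integer.Tactic.RingSolver using (solve-∀)

evalPoly-sub-∣ : ∀ f x y → (x - y) ∣ evalPoly f x - evalPoly f y
evalPoly-sub-∣ []       x y = divides ℤ.0ℤ (≡.sym (ℤ.*-zeroˡ (x - y)))
evalPoly-sub-∣ (c ∷ cs) x y = begin
  x - y                        ∣⟨ ℤ∣ₛ.∣m∣n⇒∣m+n (ℤ∣ₛ.∣n⇒∣m*n x (evalPoly-sub-∣ cs x y))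
                                                 (ℤ∣ₛ.∣m⇒∣m*n Py ℤ∣ₛ.∣-refl) ⟩
  x * (Px - Py) + (x - y) * Py ≡⟨ regroup c x y Px Py ⟨
  (c + x * Px) - (c + y * Py)  ∎
  where
  open ℤ∣ₛ.∣-Reasoning
  Px = evalPoly cs x
  Py = evalPoly cs y
  regroup : ∀ c x y u v → (c + x * u) - (c + y * v) ≡ x * (u - v) + (x - y) * v
  regroup = solve-∀

coprime-*ʳ : ∀ {m n o} → Coprime m n → Coprime m o → Coprime m (n ℕ.* o)
coprime-*ʳ {o = o} m⊥n m⊥o (d∣m , d∣no) =
  m⊥o (d∣m , ℕCoprime.coprime-factors m⊥n (ℕ.∣m⇒∣m*n o d∣m , d∣no))

coprime-^ʳ : ∀ {m n} k → Coprime m n → Coprime m (n ^ k)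
coprime-^ʳ zero    m⊥n = ℕCoprime.sym (ℕCoprime.1-coprimeTo _)
coprime-^ʳ (suc k) m⊥n = coprime-*ʳ m⊥n (coprime-^ʳ k m⊥n)

coprime-+-* : ∀ {b m} q → ℤCoprime.Coprime b m → ℤCoprime.Coprime (b + m * q) m
coprime-+-* {b} {m} q b⊥m {d} (d∣b+mq , d∣m) = b⊥m (ℤ∣ₛ.∣⇒∣ᵤ d∣b , d∣m)
  where
  d∣b : + d ∣ b
  d∣b = ℤ∣ₛ.∣m+n∣n⇒∣m (ℤ∣ₛ.∣ᵤ⇒∣ d∣b+mq) (ℤ∣ₛ.∣m⇒∣m*n {m = m} q (ℤ∣ₛ.∣ᵤ⇒∣ d∣m))

i%ℕn≡j%ℕn⇒n∣ᵤi-j : ∀ {n} .{{_ : NonZero n}} i j → i %ℕ n ≡ j %ℕ n → + n ∣ᵤ i - j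
i%ℕn≡j%ℕn⇒n∣ᵤi-j {n} i j i≡j = ℤ∣ₛ.∣⇒∣ᵤ (divides (qi - qj) (begin
  i - j                                 ≡⟨ ≡.cong₂ _-_ (a≡a%ℕn+[a/ℕn]*n i n) (a≡a%ℕn+[a/ℕn]*n j n) ⟩
  (+ ri + qi * + n) - (+ rj + qj * + n) ≡⟨ ≡.cong (λ r → (+ r + qi * + n) - (+ rj + qj * + n)) i≡j ⟩
  (+ rj + qi * + n) - (+ rj + qj * + n) ≡⟨ cancel (+ rj) qi qj (+ n) ⟩
  (qi - qj) * + n                       ∎))
  where
  open ≡.≡-Reasoning
  qi = i /ℕ n
  qj = j /ℕ n
  ri = i %ℕ n
  rj = j %ℕ n
  cancel : ∀ r u v n → (r + u * n) - (r + v * n) ≡ (u - v) * n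
  cancel = solve-∀

m<d∧n<d∧d∣m-n⇒m≡n : ∀ {d m n} → m < d → n < d → + d ∣ᵤ + m - + n → m ≡ n
m<d∧n<d∧d∣m-n⇒m≡n {d} {m} {n} m<d n<d d∣m-n =
  ℤ.+-injective (ℤ.i-j≡0⇒i≡j (+ m) (+ n) (ℤ.∣i∣≡0⇒i≡0 (smaller-multiple≡0 d∣m-n ∣m-n∣<d)))
  where
  smaller-multiple≡0 : ∀ {x} → d ℕ.∣ x → x < d → x ≡ 0
  smaller-multiple≡0 {zero}  _   _   = ≡.refl
  smaller-multiple≡0 {suc _} d∣x x<d = contradiction (ℕ.∣⇒≤ d∣x) (ℕ.<⇒≱ x<d)
  ∣m-n∣<d : ∣ + m - + n ∣ < d
  ∣m-n∣<d = ≡.subst (_< d) (≡.cong ∣_∣ (≡.sym (ℤ.m-n≡m⊖n m n)))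
                    (ℕ.≤-<-trans (ℤ.∣m⊝n∣≤m⊔n m n) (ℕ.⊔-pres-<m m<d n<d))

CoprimeSlopes : ℕ → (ℕ → ℤ) → Set
CoprimeSlopes n h = ∀ s t → ∃ λ u → ℤCoprime.Coprime u (+ n) × h s - h t ≡ u * (+ s - + t)

residue-injective : ∀ {n} .{{_ : NonZero n}} h → CoprimeSlopes n h →
                    ∀ s t → s < n → t < n → h s %ℕ n ≡ h t %ℕ n → s ≡ t
residue-injective {n} h slopes s t s<n t<n hs≡ht with slopes s t
... | u , u⊥n , hs-ht≡u[s-t] = m<d∧n<d∧d∣m-n⇒m≡n s<n t<n
  (ℤCoprime.coprime-divisor (+ n) u (+ s - + t) (ℤCoprime.sym {u} {+ n} u⊥n)
    (≡.subst (+ n ∣ᵤ_) hs-ht≡u[s-t] (i%ℕn≡j%ℕn⇒n∣ᵤi-j (h s) (h t) hs≡ht)))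

linear-slopes : ∀ {p} k a b → Coprime ∣ b ∣ p → CoprimeSlopes (p ^ k) (λ t → a + b * + t)
linear-slopes k a b b⊥p s t = b , coprime-^ʳ k b⊥p , slope a b (+ s) (+ t)
  where
  slope : ∀ a b x y → (a + b * x) - (a + b * y) ≡ b * (x - y)
  slope = solve-∀

polynomial-slopes : ∀ {p} k a b f → Coprime ∣ b ∣ p →
                    CoprimeSlopes (p ^ k) (λ t → a + b * + t + + p * evalPoly f (+ t))
polynomial-slopes {p} k a b f b⊥p s t with evalPoly-sub-∣ f (+ s) (+ t)
... | divides q fs-ft≡q[s-t] = b + + p * q , coprime-^ʳ k (coprime-+-* {b} {+ p} q b⊥p) , (begin
  (a + b * + s + + p * fs) - (a + b * + t + + p * ft) ≡⟨ split a b (+ p) (+ s) (+ t) fs ft ⟩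
  b * (+ s - + t) + + p * (fs - ft)                   ≡⟨ ≡.cong (λ d → b * (+ s - + t) + + p * d) fs-ft≡q[s-t] ⟩
  b * (+ s - + t) + + p * (q * (+ s - + t))           ≡⟨ collect b (+ p) q (+ s - + t) ⟩
  (b + + p * q) * (+ s - + t)                         ∎)
  where
  open ≡.≡-Reasoning
  fs = evalPoly f (+ s)
  ft = evalPoly f (+ t)
  split : ∀ a b p x y u v → (a + b * x + p * u) - (a + b * y + p * v) ≡ b * (x - y) + p * (u - v)
  split = solve-∀
  collect : ∀ b p q d → b * d + p * (q * d) ≡ (b + p * q) * d
  collect = solve-∀

proposition5p7 : ∀ {c ℓ} (R : CommutativeRing c ℓ) → NoZeroDivisors R →
    (p : ℕ) (pp : Prime p) → p ≢ 2 →
    (a b : ℤ) (k : ℕ) → 1 ≤ k → Coprime ∣ b ∣ p →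
    (ζ : CommutativeRing.Carrier R) → IsPrimitiveRoot R ζ (p ^ k) →
    (f : List ℤ) →
    RingEq R (sumBelow R (p ^ k) (λ t → powMod R p k pp ζ (a + b * (+ t) + (+ p) * evalPoly f (+ t))))
             (sumBelow R (p ^ k) (λ t → powMod R p k pp ζ (a + b * (+ t))))
    × RingEq R (sumBelow R (p ^ k) (λ t → powMod R p k pp ζ (a + b * (+ t)))) (CommutativeRing.0# R)
proposition5p7 R noZeroDivisors p pp _ a b k 1≤k b⊥p ζ ζ-primitive f =
  trans (sum-vanishes g g-slopes) (sym (sum-vanishes g₀ g₀-slopes)) ,
  sum-vanishes g₀ g₀-slopes
  where
  open CommutativeRing R using (_≈_; 0#; trans; sym)
  N = p ^ k
  instance
    N≢0 : NonZero N
    N≢0 = ℕ.m^n≢0 p k {{prime⇒nonZero pp}}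
  1<N : 1 < N
  1<N = ℕ.^-monoʳ-< p (ℕ.nonTrivial⇒n>1 p {{prime⇒nonTrivial pp}}) 1≤k
  g g₀ : ℕ → ℤ
  g  t = a + b * + t + + p * evalPoly f (+ t)
  g₀ t = a + b * + t
  g-slopes : CoprimeSlopes N g
  g-slopes = polynomial-slopes k a b f b⊥p
  g₀-slopes : CoprimeSlopes N g₀
  g₀-slopes = linear-slopes k a b b⊥p
  sum-vanishes : ∀ h → CoprimeSlopes N h → sumBelow R N (λ t → powMod R p k pp ζ (h t)) ≈ 0#
  sum-vanishes h slopes = trans
    (sumBelow-reindex R N _ (λ t → h t %ℕ N) (λ t _ → n%ℕd<d (h t) N) (residue-injective h slopes))
    (sumBelow-rootOfUnity≈0 R noZeroDivisors N (proj₁ ζ-primitive) (primitiveRoot⇒≉1 R ζ-primitive 1<N))
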